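{- Let $\mu=(\mathrm{Val},(\mathcal P,\mathcal O),\varsigma)$ be a model with $\mathrm{Val}=\{0,0.5,1\}$ for the predicate symbols $\mathrm{input},\mathrm{echo}_1,\mathrm{echo}_2,\mathrm{output}$, whose semitopology $(\mathcal P,\mathcal O)$ is 3-twined, and suppose every axiom of $\mathrm{ThyCA}$ is valid in $\mu$. Then for all $v,v'\in\{0,1\}$, $$\models(\mathsf{Somewhere}\,\mathrm{output}(v)\wedge\mathsf{Somewhere}\,\mathrm{output}(v'))\to_s (v\doteq v').$$
   Context: Truth values: $\mathbf 3=\{\mathbf f,\mathbf b,\mathbf t\}$ totally ordered by $\mathbf f<\mathbf b<\mathbf t$; $\wedge,\vee$ are min and max, $\bigwedge,\bigvee$ are infimum and supremum. Negation: $\neg\mathbf t=\mathbf f$, $\neg\mathbf b=\mathbf b$, $\neg\mathbf f=\mathbf t$. Modalities: $\mathsf T x=\mathbf t$ if $x=\mathbf t$, else $\mathbf f$; $\mathsf B x=\mathbf t$ if $x=\mathbf b$, else $\mathbf f$; $\mathsf{TF}x=\mathbf t$ if $x\in\{\mathbf t,\mathbf f\}$, else $\mathbf f$. Weak implication $x\to_w y:=\neg x\vee y$; strong implication $x\to_s y:=\neg x\vee\mathsf T y$. Exclusive-or: $x\oplus y=\mathbf b$ if $x=\mathbf b$ or $y=\mathbf b$; otherwise $x\oplus y=\mathbf t$ if $x\neq y$ and $\mathbf f$ if $x=y$. A truth value is valid iff it lies in $\{\mathbf t,\mathbf b\}$. A semitopology $(\mathcal P,\mathcal O)$ is a set $\mathcal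 P$ with a family $\mathcal O$ of subsets containing $\mathcal P$ and closed under arbitrary (including empty) unions; $\mathcal O^{\neq\emptyset}$ is the set of nonempty members. It is 3-twined if any three members of $\mathcal O^{\neq\emptyset}$ have nonempty intersection. For $f:\mathcal P\to\mathbf 3$: $\mathsf{Everywhere} f=\bigwedge_{p}f(p)$, $\mathsf{Somewhere} f=\bigvee_p f(p)$, $\mathsf{Quorum} f=\bigvee_{O\in\mathcal O^{\neq\emptyset}}\bigwedge_{p\in O}f(p)$, $\mathsf{Contraquorum} f=\bigwedge_{O\in\mathcal O^{\neq\emptyset}}\bigvee_{p\in O}f(p)$. Logic: a model $\mu=(\mathrm{Val},(\mathcal P,\mathcal O),\varsigma)$ consists of a nonempty set $\mathrm{Val}$, a semitopology, and for each predicate symbol $R$ a function $\varsigma(R):\mathcal P\to\mathrm{Val}\to\mathbf 3$. Formulas are built from atoms $R(t)$, value equalities $v\doteq v'$ (denoting $\mathbf t$ if $v=v'$, else $\mathbf f$), connectives $\neg,\wedge,\vee,\to_w,\to_s,\oplus$, modalities $\mathsf T,\mathsf B,\mathsf{TF}$, operators $\mathsf{Everywhere},\mathsf{Somewhere},\mathsf{Quorum},\mathsf{Contraquorum}$ and quantifiers over $\mathrm{Val}$. Denotation $[\![\phi]\!]:\mathcal P\to\mathbf 3$: $[\![R(v)]\!](p)=\varsigma(R)(p)(v)$; connectives and modalities act pointwise in $p$; $[\![\mathsf{Quorum}\,\phi]\!](p)=\mathsf{Quorum}([\![\phi]\!])$ for all $p$, likewise for the other three operators; $[\![\exists a.\phi]\!](p)=\bigvee_{v}[\![\phi[a:=v]]\!](p)$,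 $[\![\forall a.\phi]\!](p)=\bigwedge_{v}[\![\phi[a:=v]]\!](p)$; $[\![\exists_{01}a.\phi]\!](p)=\bigwedge_{v,v'}\big(([\![\phi[a:=v]]\!](p)\wedge[\![\phi[a:=v']]\!](p))\to_w (v\doteq v')\big)$. $p\models\phi$ iff $[\![\phi]\!](p)\in\{\mathbf t,\mathbf b\}$; $\models\phi$ iff $p\models\phi$ for all $p$. $\mathrm{correct}(R):=\forall a.\mathsf{TF}R(a)$, $\mathrm{incorrect}(R):=\forall a.\mathsf B R(a)$, and $\mathrm{correct}(R_1,\dots,R_n):=\bigwedge_i\mathrm{correct}(R_i)$. Axioms with a free variable $a$ are universally quantified over $a$; an axiom is valid in $\mu$ if $\models$ it. $\mathrm{ThyCA}$ (with $\mathrm{Val}=\{0,0.5,1\}$) consists of: CaEcho1?: $\mathrm{echo}_1(a)\to_s\mathsf{Somewhere}\,\mathrm{input}(a)$; CaEcho2?: $\mathrm{echo}_2(a)\to_w\mathsf{Quorum}\,\mathrm{echo}_1(a)$; CaOutput?: $(\mathrm{output}(0)\to_w\mathsf{Quorum}\,\mathrm{echo}_2(0))\wedge(\mathrm{output}(1)\to_w\mathsf{Quorum}\,\mathrm{echo}_2(1))$; CaOutput'?: $\mathrm{output}(0.5)\to_w(\mathsf{Quorum}\,\mathrm{echo}_1(0)\wedge\mathsf{Quorum}\,\mathrm{echo}_1(1))$; CaCorrect: $\mathsf{Quorum}\,\mathrm{correct}(\mathrm{input},\mathrm{echo}_1,\mathrm{echo}_2,\mathrm{output})$; CaCorrect':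 $\mathrm{correct}(R)\vee\mathrm{incorrect}(R)$ for each $R\in\{\mathrm{input},\mathrm{echo}_1,\mathrm{echo}_2,\mathrm{output}\}$; CaInput: $(\mathrm{input}(0)\oplus\mathrm{input}(1))\wedge\neg\mathrm{input}(0.5)$; CaEcho2$_{01}$: $\exists_{01}a.\mathrm{echo}_2(a)$; CaEcho1!: $(\mathrm{input}(a)\vee\mathsf{Contraquorum}\,\mathrm{echo}_1(a))\to_w\mathrm{echo}_1(a)$; CaEcho2!: $(\exists a.\mathsf{Quorum}\,\mathrm{echo}_1(a))\to_w\exists a.\mathrm{echo}_2(a)$; CaOutput!: $\mathsf{Quorum}\,\mathrm{echo}_2(a)\to_w\mathrm{output}(a)$; CaOutput'!: $(\mathsf{Quorum}\,\mathrm{echo}_1(0)\wedge\mathsf{Quorum}\,\mathrm{echo}_1(1))\to_w\mathrm{output}(0.5)$. -}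

module Defs where

open import Data.Product using (Σ; _×_; _,_; proj₁; proj₂)
open import Data.Sum using (_⊎_; inj₁; inj₂)
open import Data.Empty using (⊥)
open import Data.Unit using (⊤)
open import Relation.Nullary using (¬_)
open import Relation.Binary.PropositionalEquality using (_≡_)
open import Level using (Lift; lift; lower)

data 𝟛 : Set where
  𝕗 𝕓 𝕥 : 𝟛

≥𝕓 : 𝟛 → Set
≥𝕓 𝕗 = ⊥
≥𝕓 𝕓 = ⊤
≥𝕓 𝕥 = ⊤

≥𝕥 : 𝟛 → Set
≥𝕥 𝕥 = ⊤
≥𝕥 _ = ⊥

-- Because infima/suprema range over
-- arbitrary (possibly infinite) families, a truth value of 𝟛 is encoded
-- by its two upper-set memberships  "x ≥ b"  and  "x ≥ t"  (classically
-- this is exactly the totally ordered set f < b < t).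
-- (The fields live in Set₁ because Quorum quantifies over open sets.)
record TV : Set₂ where
  field
    atLeastB : Set₁
    atLeastT : Set₁
    t⇒b      : atLeastT → atLeastB
open TV public

⌜_⌝ : 𝟛 → TV
⌜ x ⌝ = record { atLeastB = Lift _ (≥𝕓 x) ; atLeastT = Lift _ (≥𝕥 x) ; t⇒b = λ h → lift (g x (lower h)) }
  where
  g : (x : 𝟛) → ≥𝕥 x → ≥𝕓 x
  g 𝕥 _ = _

Valid : TV → Set₁
Valid x = atLeastB x

-- negation: ¬x ≥ b iff x ≤ b iff not (x ≥ t);  ¬x ≥ t iff x = f
~_ : TV → TV
~ x = record { atLeastB = ¬ atLeastT x ; atLeastT = ¬ atLeastB x
             ; t⇒b = λ nb t → nb (t⇒b x t) }

_∧ᵗ_ : TV → TV → TV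
x ∧ᵗ y = record { atLeastB = atLeastB x × atLeastB y
                ; atLeastT = atLeastT x × atLeastT y
                ; t⇒b = λ { (a , c) → t⇒b x a , t⇒b y c } }

_∨ᵗ_ : TV → TV → TV
x ∨ᵗ y = record { atLeastB = atLeastB x ⊎ atLeastB y
                ; atLeastT = atLeastT x ⊎ atLeastT y
                ; t⇒b = λ { (inj₁ a) → inj₁ (t⇒b x a) ; (inj₂ a) → inj₂ (t⇒b y a) } }

⋀ : {I : Set} → (I → TV) → TV
⋀ {I} f = record { atLeastB = (i : I) → atLeastB (f i)
                 ; atLeastT = (i : I) → atLeastT (f i)
                 ; t⇒b = λ h i → t⇒b (f i) (h i) }

⋁ : {I : Set} → (I → TV) → TV
⋁ {I} f = record { atLeastB = Σ I (λ i → atLeastB (f i))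
                 ; atLeastT = Σ I (λ i → atLeastT (f i))
                 ; t⇒b = λ { (i , h) → i , t⇒b (f i) h } }

𝖳 : TV → TV
𝖳 x = record { atLeastB = atLeastT x ; atLeastT = atLeastT x ; t⇒b = λ h → h }

𝖡 : TV → TV
𝖡 x = record { atLeastB = atLeastB x × ¬ atLeastT x
             ; atLeastT = atLeastB x × ¬ atLeastT x ; t⇒b = λ h → h }

𝖳𝖥 : TV → TV
𝖳𝖥 x = record { atLeastB = atLeastT x ⊎ ¬ atLeastB x
              ; atLeastT = atLeastT x ⊎ ¬ atLeastB x ; t⇒b = λ h → h }

_→w_ : TV → TV → TV
x →w y = (~ x) ∨ᵗ y

_→s_ : TV → TV → TV
x →s y = (~ x) ∨ᵗ 𝖳 y

_⊕_ : TV → TV → TV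
x ⊕ y = record { atLeastB = isB x ⊎ (isB y ⊎ differ)
               ; atLeastT = differ
               ; t⇒b = λ h → inj₂ (inj₂ h) }
  where
  isB : TV → Set₁
  isB z = atLeastB z × ¬ atLeastT z
  isF : TV → Set₁
  isF z = ¬ atLeastB z
  differ : Set₁
  differ = (atLeastT x × isF y) ⊎ (isF x × atLeastT y)

data Val : Set where
  v0 v½ v1 : Val

_≐_ : Val → Val → TV
v ≐ v' = record { atLeastB = Lift _ (v ≡ v') ; atLeastT = Lift _ (v ≡ v') ; t⇒b = λ h → h }

record Semitopology : Set₁ where
  field
    Pt       : Set
    Open     : (Pt → Set) → Set
    open-all : Open (λ _ → ⊤)
    open-⋃   : (I : Set) (U : I → Pt → Set) → ((i : I) → Open (U i)) →
               Open (λ p → Σ I (λ i → U i p))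
open Semitopology public

Nonempty : {P : Set} → (P → Set) → Set
Nonempty {P} U = Σ P U

ThreeTwined : Semitopology → Set₁
ThreeTwined S = (U₁ U₂ U₃ : Pt S → Set) →
  Open S U₁ → Nonempty U₁ → Open S U₂ → Nonempty U₂ → Open S U₃ → Nonempty U₃ →
  Σ (Pt S) (λ p → U₁ p × U₂ p × U₃ p)

NEOpen : (S : Semitopology) → Set₁
NEOpen S = Σ (Pt S → Set) (λ U → Open S U × Nonempty U)

Everywhere : (S : Semitopology) → (Pt S → TV) → TV
Everywhere S f = ⋀ f

Somewhere : (S : Semitopology) → (Pt S → TV) → TV
Somewhere S f = ⋁ f

-- sup over nonempty opens O of inf over p ∈ O (family indexed by a Set₁,
-- so written out directly)
Quorum : (S : Semitopology) → (Pt S → TV) → TV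
Quorum S f = record
  { atLeastB = Σ (Pt S → Set) (λ U → Open S U × Nonempty U × ((p : Pt S) → U p → atLeastB (f p)))
  ; atLeastT = Σ (Pt S → Set) (λ U → Open S U × Nonempty U × ((p : Pt S) → U p → atLeastT (f p)))
  ; t⇒b = λ { (U , o , n , h) → U , o , n , λ p u → t⇒b (f p) (h p u) } }

Contraquorum : (S : Semitopology) → (Pt S → TV) → TV
Contraquorum S f = record
  { atLeastB = (U : Pt S → Set) → Open S U → Nonempty U → Σ (Pt S) (λ p → U p × atLeastB (f p))
  ; atLeastT = (U : Pt S → Set) → Open S U → Nonempty U → Σ (Pt S) (λ p → U p × atLeastT (f p))
  ; t⇒b = λ h U o n → proj₁ (h U o n) , proj₁ (proj₂ (h U o n)) , t⇒b (f (proj₁ (h U o n))) (proj₂ (proj₂ (h U o n))) }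

record Model : Set₁ where
  field
    sto    : Semitopology
    input  : Pt sto → Val → 𝟛
    echo₁  : Pt sto → Val → 𝟛
    echo₂  : Pt sto → Val → 𝟛
    output : Pt sto → Val → 𝟛
open Model public

Den : Model → Set₂
Den M = Pt (sto M) → TV

atom : (M : Model) → (Pt (sto M) → Val → 𝟛) → Val → Den M
atom M R v p = ⌜ R p v ⌝

⊨ : (M : Model) → Den M → Set₁
⊨ M φ = (p : Pt (sto M)) → Valid (φ p)

_∧ᵈ_ _∨ᵈ_ _→wᵈ_ _→sᵈ_ _⊕ᵈ_ : {P : Set} → (P → TV) → (P → TV) → (P → TV)
(φ ∧ᵈ ψ) p = φ p ∧ᵗ ψ p
(φ ∨ᵈ ψ) p = φ p ∨ᵗ ψ p
(φ →wᵈ ψ) p = φ p →w ψ p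
(φ →sᵈ ψ) p = φ p →s ψ p
(φ ⊕ᵈ ψ) p = φ p ⊕ ψ p

~ᵈ_ : {P : Set} → (P → TV) → (P → TV)
(~ᵈ φ) p = ~ φ p

Qᵈ CQᵈ SWᵈ : (M : Model) → Den M → Den M
Qᵈ M φ _ = Quorum (sto M) φ
CQᵈ M φ _ = Contraquorum (sto M) φ
SWᵈ M φ _ = Somewhere (sto M) φ

∃ᵈ ∀ᵈ : {P : Set} → (Val → P → TV) → (P → TV)
∃ᵈ φ p = ⋁ (λ v → φ v p)
∀ᵈ φ p = ⋀ (λ v → φ v p)

∃₀₁ᵈ : {P : Set} → (Val → P → TV) → (P → TV)
∃₀₁ᵈ φ p = ⋀ (λ (w : Val × Val) →
  (φ (proj₁ w) p ∧ᵗ φ (proj₂ w) p) →w (proj₁ w ≐ proj₂ w))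

correct : (M : Model) → (Pt (sto M) → Val → 𝟛) → Den M
correct M R p = ⋀ (λ a → 𝖳𝖥 ⌜ R p a ⌝)

incorrect : (M : Model) → (Pt (sto M) → Val → 𝟛) → Den M
incorrect M R p = ⋀ (λ a → 𝖡 ⌜ R p a ⌝)

record ThyCA (M : Model) : Set₂ where
  private
    inp = atom M (input M)
    e₁  = atom M (echo₁ M)
    e₂  = atom M (echo₂ M)
    out = atom M (output M)
  field
    CaEcho1?   : (a : Val) → ⊨ M (e₁ a →sᵈ SWᵈ M (inp a))
    CaEcho2?   : (a : Val) → ⊨ M (e₂ a →wᵈ Qᵈ M (e₁ a))
    CaOutput?  : ⊨ M ((out v0 →wᵈ Qᵈ M (e₂ v0)) ∧ᵈ (out v1 →wᵈ Qᵈ M (e₂ v1)))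
    CaOutput'? : ⊨ M (out v½ →wᵈ (Qᵈ M (e₁ v0) ∧ᵈ Qᵈ M (e₁ v1)))
    CaCorrect  : ⊨ M (Qᵈ M (((correct M (input M) ∧ᵈ correct M (echo₁ M))
                          ∧ᵈ correct M (echo₂ M)) ∧ᵈ correct M (output M)))
    CaCorrect'-input  : ⊨ M (correct M (input M) ∨ᵈ incorrect M (input M))
    CaCorrect'-echo₁  : ⊨ M (correct M (echo₁ M) ∨ᵈ incorrect M (echo₁ M))
    CaCorrect'-echo₂  : ⊨ M (correct M (echo₂ M) ∨ᵈ incorrect M (echo₂ M))
    CaCorrect'-output : ⊨ M (correct M (output M) ∨ᵈ incorrect M (output M))
    CaInput    : ⊨ M ((inp v0 ⊕ᵈ inp v1) ∧ᵈ (~ᵈ inp v½))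
    CaEcho2₀₁  : ⊨ M (∃₀₁ᵈ e₂)
    CaEcho1!   : (a : Val) → ⊨ M ((inp a ∨ᵈ CQᵈ M (e₁ a)) →wᵈ e₁ a)
    CaEcho2!   : ⊨ M (∃ᵈ (λ a → Qᵈ M (e₁ a)) →wᵈ ∃ᵈ e₂)
    CaOutput!  : (a : Val) → ⊨ M (Qᵈ M (e₂ a) →wᵈ out a)
    CaOutput'! : ⊨ M ((Qᵈ M (e₁ v0) ∧ᵈ Qᵈ M (e₁ v1)) →wᵈ out v½)

{-# OPTIONS --safe #-}
-- An output v ∈ {0,1} that is true somewhere yields, by CaOutput?, a quorum
-- on which echo₂(v) is valid.  In a 3-twined semitopology two such quorums
-- meet inside the quorum of correct points given by CaCorrect; at a correct
-- point a valid value is true, so CaEcho2₀₁ forces the two values to agree.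
module Submission where

open import Defs
open import Data.Sum using (_⊎_; inj₁; inj₂)
open import Data.Product using (Σ; _×_; _,_; proj₁; proj₂)
open import Data.Empty using (⊥-elim)
open import Level using (lift; lower)
open import Relation.Nullary using (yes; no)
open import Relation.Binary.Definitions using (DecidableEquality)
open import Relation.Binary.PropositionalEquality using (_≡_; refl)

_≟ᵥ_ : DecidableEquality Val
v0 ≟ᵥ v0 = yes refl
v0 ≟ᵥ v½ = no λ ()
v0 ≟ᵥ v1 = no λ ()
v½ ≟ᵥ v0 = no λ ()
v½ ≟ᵥ v½ = yes refl
v½ ≟ᵥ v1 = no λ ()
v1 ≟ᵥ v0 = no λ ()
v1 ≟ᵥ v½ = no λ ()
v1 ≟ᵥ v1 = yes refl

→w-mp : (x y : TV) → Valid (x →w y) → atLeastT x → Valid y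
→w-mp _ _ (inj₁ x≱t) x≥t = ⊥-elim (x≱t x≥t)
→w-mp _ _ (inj₂ y≥b) _ = y≥b

valid∧𝖳𝖥⇒true : (x : TV) → Valid x → Valid (𝖳𝖥 x) → atLeastT x
valid∧𝖳𝖥⇒true _ _   (inj₁ x≥t) = x≥t
valid∧𝖳𝖥⇒true _ x≥b (inj₂ x≱b) = ⊥-elim (x≱b x≥b)

→s-≐-valid : (x : TV) (v v' : Val) → (atLeastT x → v ≡ v') → Valid (x →s (v ≐ v'))
→s-≐-valid _ v v' x⇒eq with v ≟ᵥ v'
... | yes eq  = inj₂ (lift eq)
... | no  neq = inj₁ λ x≥t → neq (x⇒eq x≥t)

Quorum-inhabited : (S : Semitopology) (f : Pt S → TV) → Valid (Quorum S f) → Pt S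
Quorum-inhabited _ _ (_ , _ , (p , _) , _) = p

Quorum-meet₃ : (S : Semitopology) → ThreeTwined S → (f g h : Pt S → TV) →
  Valid (Quorum S f) → Valid (Quorum S g) → Valid (Quorum S h) →
  Σ (Pt S) λ p → Valid (f p) × Valid (g p) × Valid (h p)
Quorum-meet₃ _ tw _ _ _ (U , oU , nU , fU) (V , oV , nV , gV) (W , oW , nW , hW)
  with tw U V W oU nU oV nV oW nW
... | p , p∈U , p∈V , p∈W = p , fU p p∈U , gV p p∈V , hW p p∈W

module _ {M : Model} (T : ThyCA M) where
  open ThyCA T

  private
    out e₂ : Val → Den M
    out = atom M (output M)
    e₂  = atom M (echo₂ M)
    correct-all : Den M
    correct-all = ((correct M (input M) ∧ᵈ correct M (echo₁ M))
                    ∧ᵈ correct M (echo₂ M)) ∧ᵈ correct M (output M)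

  echo₂-Quorum-unique : ThreeTwined (sto M) → {a a' : Val} →
    Valid (Quorum (sto M) (e₂ a)) → Valid (Quorum (sto M) (e₂ a')) → a ≡ a'
  echo₂-Quorum-unique tw {a} {a'} Qa Qa'
    with Quorum-meet₃ (sto M) tw (e₂ a) (e₂ a') correct-all Qa Qa'
           (CaCorrect (Quorum-inhabited (sto M) (e₂ a) Qa))
  ... | x , e₂a , e₂a' , (_ , e₂-correct) , _ =
    lower (→w-mp (e₂ a x ∧ᵗ e₂ a' x) (a ≐ a') (CaEcho2₀₁ x (a , a'))
                 (e₂-true a e₂a , e₂-true a' e₂a'))
    where
    e₂-true : (b : Val) → Valid (e₂ b x) → atLeastT (e₂ b x)
    e₂-true b e₂b = valid∧𝖳𝖥⇒true (e₂ b x) e₂b (e₂-correct b)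

  output-true⇒echo₂-Quorum : {v : Val} → v ≡ v0 ⊎ v ≡ v1 → (p : Pt (sto M)) →
    atLeastT (out v p) → Valid (Quorum (sto M) (e₂ v))
  output-true⇒echo₂-Quorum (inj₁ refl) p =
    →w-mp (out v0 p) (Quorum (sto M) (e₂ v0)) (proj₁ (CaOutput? p))
  output-true⇒echo₂-Quorum (inj₂ refl) p =
    →w-mp (out v1 p) (Quorum (sto M) (e₂ v1)) (proj₂ (CaOutput? p))

proposition5p9 : (M : Model) → ThreeTwined (sto M) → ThyCA M →
    (v v' : Val) → (v ≡ v0 ⊎ v ≡ v1) → (v' ≡ v0 ⊎ v' ≡ v1) →
    ⊨ M ((SWᵈ M (atom M (output M) v) ∧ᵈ SWᵈ M (atom M (output M) v'))
         →sᵈ (λ _ → v ≐ v'))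
proposition5p9 M tw T v v' v∈01 v'∈01 _ =
  →s-≐-valid (somewhere-output v ∧ᵗ somewhere-output v') v v'
    λ ((p , out-v) , (q , out-v')) →
      echo₂-Quorum-unique T tw (output-true⇒echo₂-Quorum T v∈01 p out-v)
                               (output-true⇒echo₂-Quorum T v'∈01 q out-v')
  where
  somewhere-output : Val → TV
  somewhere-output a = Somewhere (sto M) (atom M (output M) a)
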